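{- Let $n\ge 4$ and let $a_1,\dots,a_{n-2}$ be positive integers such that the number of odd integers among them is odd. Put $k=a_1^2+\cdots+a_{n-2}^2$. For a positive integer $\Delta$ put $$a_{n-1}=\frac{k-\Delta^2}{2\Delta},\qquad a_n=a_{n-1}+\Delta .$$ Then $a_{n-1},a_n$ are positive integers and $(a_1,\dots,a_n)$ is a primitive Pythagorean $n$-tuple if and only if all of the following hold: (1) $\Delta$ divides $k$; (2) $\Delta^2<k$; (3) for every prime $p$ dividing $\gcd(a_1,\dots,a_{n-2})$, the exponent of $p$ in $\Delta$ is either $0$ or equal to the exponent of $p$ in $k$.
   Context: A Pythagorean $n$-tuple is an ordered $n$-tuple $(a_1,\dots,a_n)$ of positive integers with $a_1^2+\cdots+a_{n-1}^2=a_n^2$. It is primitive if $\gcd(a_1,\dots,a_n)=1$. For a prime $p$ and a positive integer $x$, the exponent of $p$ in $x$ is the largest $e\ge 0$ with $p^e\mid x$. -}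

module Defs where

open import Data.Nat using (ℕ; zero; suc; _+_; _*_; _^_; _≤_; _<_; _%_)
open import Data.Nat.GCD using (gcd)
open import Data.Nat.Divisibility using (_∣_)
open import Data.Vec using (Vec; []; _∷_; init; last; map; sum)
open import Data.Vec.Relation.Unary.All using (All)
open import Relation.Binary.PropositionalEquality using (_≡_)
open import Data.Product using (_×_)

numOdd : ∀ {m} → Vec ℕ m → ℕ
numOdd [] = 0
numOdd (x ∷ xs) with x % 2
... | 0 = numOdd xs
... | _ = suc (numOdd xs)

sumSq : ∀ {m} → Vec ℕ m → ℕ
sumSq v = sum (map (λ x → x * x) v)

gcdVec : ∀ {m} → Vec ℕ m → ℕ
gcdVec [] = 0
gcdVec (x ∷ xs) = gcd x (gcdVec xs)

Pythagorean : ∀ {m} → Vec ℕ (suc m) → Set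
Pythagorean v = All (λ x → 0 < x) v × sumSq (init v) ≡ last v * last v

PrimitivePythagorean : ∀ {m} → Vec ℕ (suc m) → Set
PrimitivePythagorean v = Pythagorean v × gcdVec v ≡ 1

IsExponent : ℕ → ℕ → ℕ → Set
IsExponent p x e = (p ^ e ∣ x) × (∀ e′ → p ^ e′ ∣ x → e′ ≤ e)

{-# OPTIONS --safe #-}

-- With k = a₁² + ⋯ + a_{n-2}², the defining equation reads k = Δ (2b + Δ), so a positive
-- solution b exists iff Δ ∣ k and Δ² < k: the cofactor q = k / Δ then exceeds Δ, and both
-- are odd because k is odd (it has the parity of the number of odd aᵢ), so b = (q − Δ) / 2.
-- A prime dividing every entry of the tuple divides gcd(a), b and Δ; as gcd(a) is odd, this
-- is the same as dividing gcd(a), Δ and q. Finally, for p ∣ Δ, p ∤ q holds exactly when p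
-- has the same exponent in Δ and in k = Δ q.
module Submission where

open import Defs
open import Data.Nat
open import Data.Nat.Properties
open import Data.Nat.DivMod
open import Data.Nat.Divisibility
open import Data.Nat.Induction using (<-wellFounded)
open import Data.Nat.GCD using (gcd-greatest; gcd[m,n]∣m; gcd[m,n]∣n)
open import Data.Nat.Primality
open import Data.Nat.Primality.Factorisation using (factorise)
open import Data.Nat.Tactic.RingSolver using (solve-∀)
open import Data.Vec using (Vec; []; _∷_; _∷ʳ_; init; last)
open import Data.Vec.Properties using (init-∷ʳ; last-∷ʳ)
open import Data.Vec.Relation.Unary.All using (All; []; _∷_)
open import Data.List using ([]; _∷_)
open import Data.Nat.ListAction using (product)
import Data.List.Relation.Unary.All as List
open import Data.Product
open import Data.Sum using (_⊎_; inj₁; inj₂)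
open import Induction.WellFounded using (Acc; acc)
open import Function using (_∘_)
open import Function.Bundles using (_⇔_; mk⇔; Equivalence)
open import Relation.Nullary using (¬_; contradiction; yes; no)
open import Relation.Binary.PropositionalEquality

open Equivalence using (to; from)

private
  variable
    A : Set
    m n d p x y e f : ℕ

∷ʳ⁺ : {P : A → Set} {v : Vec A n} {a : A} → All P v → P a → All P (v ∷ʳ a)
∷ʳ⁺ []         pa = pa ∷ []
∷ʳ⁺ (pb ∷ pbs) pa = pb ∷ ∷ʳ⁺ pbs pa

∷ʳ⁻ : {P : A → Set} (v : Vec A n) {a : A} → All P (v ∷ʳ a) → All P v × P a
∷ʳ⁻ []      (pa ∷ [])  = [] , pa
∷ʳ⁻ (_ ∷ v) (pb ∷ pbs) = map₁ (pb ∷_) (∷ʳ⁻ v pbs)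

sumSq-∷ʳ : (v : Vec ℕ n) → ∀ x → sumSq (v ∷ʳ x) ≡ sumSq v + x * x
sumSq-∷ʳ []      x = +-identityʳ (x * x)
sumSq-∷ʳ (y ∷ v) x = trans (cong (y * y +_) (sumSq-∷ʳ v x)) (sym (+-assoc (y * y) (sumSq v) (x * x)))

∣gcdVec⇔All∣ : (v : Vec ℕ n) → d ∣ gcdVec v ⇔ All (d ∣_) v
∣gcdVec⇔All∣ v = mk⇔ (⇒ v) (⇐ v)
  where
  ⇒ : (v : Vec ℕ n) → d ∣ gcdVec v → All (d ∣_) v
  ⇒ []      _   = []
  ⇒ (x ∷ v) d∣g = ∣-trans d∣g (gcd[m,n]∣m x (gcdVec v)) ∷ ⇒ v (∣-trans d∣g (gcd[m,n]∣n x (gcdVec v)))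
  ⇐ : (v : Vec ℕ n) → All (d ∣_) v → d ∣ gcdVec v
  ⇐ []      []           = _ ∣0
  ⇐ (x ∷ v) (d∣x ∷ d∣xs) = gcd-greatest d∣x (⇐ v d∣xs)

∣gcdVec-∷ʳ-∷ʳ⇔ : (v : Vec ℕ n) → d ∣ gcdVec ((v ∷ʳ x) ∷ʳ y) ⇔ (d ∣ gcdVec v × d ∣ x × d ∣ y)
∣gcdVec-∷ʳ-∷ʳ⇔ {n} {d} {x} {y} v = mk⇔ ⇒ ⇐
  where
  ⇒ : d ∣ gcdVec ((v ∷ʳ x) ∷ʳ y) → d ∣ gcdVec v × d ∣ x × d ∣ y
  ⇒ d∣g with ∷ʳ⁻ (v ∷ʳ x) (to (∣gcdVec⇔All∣ _) d∣g)
  ... | d∣vx , d∣y with ∷ʳ⁻ v d∣vx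
  ...   | d∣v , d∣x = from (∣gcdVec⇔All∣ v) d∣v , d∣x , d∣y
  ⇐ : d ∣ gcdVec v × d ∣ x × d ∣ y → d ∣ gcdVec ((v ∷ʳ x) ∷ʳ y)
  ⇐ (d∣g , d∣x , d∣y) = from (∣gcdVec⇔All∣ _) (∷ʳ⁺ (∷ʳ⁺ (to (∣gcdVec⇔All∣ v) d∣g) d∣x) d∣y)

All∣⇒∣sumSq : {v : Vec ℕ n} → All (d ∣_) v → d ∣ sumSq v
All∣⇒∣sumSq             []           = _ ∣0
All∣⇒∣sumSq {v = x ∷ _} (d∣x ∷ d∣xs) = ∣m∣n⇒∣m+n (∣n⇒∣m*n x d∣x) (All∣⇒∣sumSq d∣xs)

numOdd-∷ : ∀ x (v : Vec ℕ n) → numOdd (x ∷ v) ≡ x % 2 + numOdd v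
numOdd-∷ x v with x % 2 | m%n<n x 2
... | 0    | _            = refl
... | 1    | _            = refl
... | 2+ _ | s≤s (s≤s ())

[x*x]%2≡x%2 : ∀ x → x * x % 2 ≡ x % 2
[x*x]%2≡x%2 x = trans (%-distribˡ-* x x 2) (idempotent (x % 2) (m%n<n x 2))
  where
  idempotent : ∀ r → r < 2 → r * r % 2 ≡ r
  idempotent 0      _                = refl
  idempotent 1      _                = refl
  idempotent (2+ _) (s≤s (s≤s ()))

sumSq%2≡numOdd%2 : (v : Vec ℕ n) → sumSq v % 2 ≡ numOdd v % 2
sumSq%2≡numOdd%2 []      = refl
sumSq%2≡numOdd%2 (x ∷ v) = begin
  (x * x + sumSq v) % 2          ≡⟨ %-distribˡ-+ (x * x) (sumSq v) 2 ⟩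
  (x * x % 2 + sumSq v % 2) % 2  ≡⟨ cong₂ (λ r s → (r + s) % 2) ([x*x]%2≡x%2 x) (sumSq%2≡numOdd%2 v) ⟩
  (x % 2 + numOdd v % 2) % 2     ≡⟨ cong (λ r → (r + numOdd v % 2) % 2) (m%n%n≡m%n x 2) ⟨
  (x % 2 % 2 + numOdd v % 2) % 2 ≡⟨ %-distribˡ-+ (x % 2) (numOdd v) 2 ⟨
  (x % 2 + numOdd v) % 2         ≡⟨ cong (_% 2) (numOdd-∷ x v) ⟨
  numOdd (x ∷ v) % 2             ∎
  where open ≡-Reasoning

%2≡1⇒¬2∣ : x % 2 ≡ 1 → ¬ 2 ∣ x
%2≡1⇒¬2∣ {x} x%2≡1 2∣x = 0≢1+n (trans (sym (n∣m⇒m%n≡0 x 2 2∣x)) x%2≡1)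

¬2∣⇒%2≡1 : ¬ 2 ∣ x → x % 2 ≡ 1
¬2∣⇒%2≡1 {x} 2∤x with x % 2 | m%n<n x 2 | m%n≡0⇒n∣m x 2
... | 0    | _            | ⇒2∣x = contradiction (⇒2∣x refl) 2∤x
... | 1    | _            | _    = refl
... | 2+ _ | s≤s (s≤s ()) | _

¬2∣⇒≡1+[/2]*2 : ¬ 2 ∣ x → x ≡ 1 + x / 2 * 2
¬2∣⇒≡1+[/2]*2 {x} 2∤x = trans (m≡m%n+[m/n]*n x 2) (cong (_+ x / 2 * 2) (¬2∣⇒%2≡1 2∤x))

odd<odd⇒∃[b]n≡2*b+m : ¬ 2 ∣ m → ¬ 2 ∣ n → m < n → ∃[ b ] 0 < b × n ≡ 2 * b + m
odd<odd⇒∃[b]n≡2*b+m {m} {n} 2∤m 2∤n m<n = s ∸ t , m<n⇒0<n∸m t<s , n≡2*b+m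
  where
  t s : ℕ
  t = m / 2
  s = n / 2
  t<s : t < s
  t<s = *-cancelʳ-< 2 t s (+-cancelˡ-< 1 (t * 2) (s * 2)
          (subst₂ _<_ (¬2∣⇒≡1+[/2]*2 2∤m) (¬2∣⇒≡1+[/2]*2 2∤n) m<n))
  regroup : ∀ b t → 1 + (b + t) * 2 ≡ 2 * b + (1 + t * 2)
  regroup = solve-∀
  n≡2*b+m : n ≡ 2 * (s ∸ t) + m
  n≡2*b+m = begin
    n                         ≡⟨ ¬2∣⇒≡1+[/2]*2 2∤n ⟩
    1 + s * 2                 ≡⟨ cong (λ r → 1 + r * 2) (m∸n+n≡m (<⇒≤ t<s)) ⟨
    1 + (s ∸ t + t) * 2       ≡⟨ regroup (s ∸ t) t ⟩
    2 * (s ∸ t) + (1 + t * 2) ≡⟨ cong (2 * (s ∸ t) +_) (¬2∣⇒≡1+[/2]*2 2∤m) ⟨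
    2 * (s ∸ t) + m           ∎
    where open ≡-Reasoning

ExponentZeroOrEqual : ℕ → ℕ → ℕ → Set
ExponentZeroOrEqual p x y = ∀ e f → IsExponent p x e → IsExponent p y f → e ≡ 0 ⊎ e ≡ f

p^[1+e]≡p^e*p : ∀ p e → p ^ suc e ≡ p ^ e * p
p^[1+e]≡p^e*p p e = *-comm p (p ^ e)

exponent-mono : IsExponent p x e → IsExponent p y f → x ∣ y → e ≤ f
exponent-mono (p^e∣x , _) (_ , maximal) x∣y = maximal _ (∣-trans p^e∣x x∣y)

∣⇒exponent>0 : p ∣ x → IsExponent p x e → 0 < e
∣⇒exponent>0 {p} p∣x (_ , maximal) = maximal 1 (subst (_∣ _) (sym (*-identityʳ p)) p∣x)

∣⇒exponent-*-> : p ∣ m → IsExponent p x e → IsExponent p (x * m) f → e < f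
∣⇒exponent-*-> {p} {m} {x} {e} p∣m (p^e∣x , _) (_ , maximal) =
  maximal (suc e) (subst (_∣ x * m) (sym (p^[1+e]≡p^e*p p e)) (*-pres-∣ p^e∣x p∣m))

module _ (pr : Prime p) where

  private instance
    p≢0 : NonZero p
    p≢0 = prime⇒nonZero pr

  ∤⇒^∣*-cancelʳ : ¬ p ∣ m → ∀ f x → p ^ f ∣ x * m → p ^ f ∣ x
  ∤⇒^∣*-cancelʳ p∤m zero    x _         = 1∣ x
  ∤⇒^∣*-cancelʳ {m} p∤m (suc f) x p^[1+f]∣xm with euclidsLemma x m pr (m*n∣⇒m∣ p (p ^ f) p^[1+f]∣xm)
  ... | inj₂ p∣m        = contradiction p∣m p∤m
  ... | inj₁ (divides y refl) =
    subst (p ^ suc f ∣_) (*-comm p y) (*-monoʳ-∣ p (∤⇒^∣*-cancelʳ p∤m f y (*-cancelˡ-∣ p p^[1+f]∣p[ym])))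
    where
    p^[1+f]∣p[ym] : p ^ suc f ∣ p * (y * m)
    p^[1+f]∣p[ym] = subst (p ^ suc f ∣_) (trans (cong (_* m) (*-comm y p)) (*-assoc p y m)) p^[1+f]∣xm

  ∤⇒exponent-*-≡ : ¬ p ∣ m → IsExponent p x e → IsExponent p (x * m) f → e ≡ f
  ∤⇒exponent-*-≡ {m} {x} {e} {f} p∤m x-exp@(_ , maximal) xm-exp@(p^f∣xm , _) =
    ≤-antisym (exponent-mono x-exp xm-exp (m∣m*n m)) (maximal f (∤⇒^∣*-cancelʳ p∤m f x p^f∣xm))

  exponent-exists : ∀ x → .{{NonZero x}} → ∃ (IsExponent p x)
  exponent-exists x = go x (<-wellFounded x)
    where
    go : ∀ x → Acc _<_ x → .{{NonZero x}} → ∃ (IsExponent p x)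
    go x (acc smaller) with p ∣? x
    ... | no p∤x = 0 , 1∣ x , maximal
      where
      maximal : ∀ e′ → p ^ e′ ∣ x → e′ ≤ 0
      maximal zero     _         = z≤n
      maximal (suc e′) p^[1+e′]∣x = contradiction (m*n∣⇒m∣ p (p ^ e′) p^[1+e′]∣x) p∤x
    ... | yes (divides y refl) = suc eʸ , p^[1+e]∣yp , maximal
      where
      instance
        y≢0 : NonZero y
        y≢0 = m*n≢0⇒m≢0 y
      y-exp : ∃ (IsExponent p y)
      y-exp = go y (smaller (m<m*n y p (nonTrivial⇒n>1 p {{prime⇒nonTrivial pr}})))
      eʸ : ℕ
      eʸ = proj₁ y-exp
      p^[1+e]∣yp : p ^ suc eʸ ∣ y * p
      p^[1+e]∣yp = subst (_∣ y * p) (sym (p^[1+e]≡p^e*p p eʸ)) (*-pres-∣ (proj₁ (proj₂ y-exp)) ∣-refl)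
      maximal : ∀ e′ → p ^ e′ ∣ y * p → e′ ≤ suc eʸ
      maximal zero     _          = z≤n
      maximal (suc e′) p^[1+e′]∣yp =
        s≤s (proj₂ (proj₂ y-exp) e′ (*-cancelʳ-∣ p (subst (_∣ y * p) (p^[1+e]≡p^e*p p e′) p^[1+e′]∣yp)))

  exponentZeroOrEqual⇔∤cofactor : y ≡ x * m → .{{NonZero y}} → ExponentZeroOrEqual p x y ⇔ (p ∣ x → ¬ p ∣ m)
  exponentZeroOrEqual⇔∤cofactor {x = x} {m} refl = mk⇔ ⇒ ⇐
    where
    ⇒ : ExponentZeroOrEqual p x (x * m) → p ∣ x → ¬ p ∣ m
    ⇒ zeroOrEqual p∣x p∣m
      with e , x-exp ← exponent-exists x {{m*n≢0⇒m≢0 x}}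
         | f , xm-exp ← exponent-exists (x * m)
      with zeroOrEqual e f x-exp xm-exp
    ... | inj₁ e≡0 = >⇒≢ (∣⇒exponent>0 p∣x x-exp) e≡0
    ... | inj₂ e≡f = <⇒≢ (∣⇒exponent-*-> p∣m x-exp xm-exp) e≡f
    ⇐ : (p ∣ x → ¬ p ∣ m) → ExponentZeroOrEqual p x (x * m)
    ⇐ _         zero    _ _      _      = inj₁ refl
    ⇐ p∣x⇒p∤m (suc e) f x-exp xm-exp =
      inj₂ (∤⇒exponent-*-≡ (p∣x⇒p∤m (m*n∣⇒m∣ p (p ^ e) (proj₁ x-exp))) x-exp xm-exp)

≢1⇒∃primeDivisor : n ≢ 1 → ∃[ p ] Prime p × p ∣ n
≢1⇒∃primeDivisor {zero}  _ = 2 , prime[2] , 2 ∣0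
≢1⇒∃primeDivisor {suc n} n≢1 with factorise (suc n)
... | record { factors = [] ; isFactorisation = n≡1 } = contradiction n≡1 n≢1
... | record { factors = p ∷ ps ; isFactorisation = n≡p*ps ; factorsPrime = pr List.∷ _ } =
  p , pr , divides (product ps) (trans n≡p*ps (*-comm p (product ps)))

≡1⇔noPrimeDivisor : n ≡ 1 ⇔ (∀ p → Prime p → ¬ p ∣ n)
≡1⇔noPrimeDivisor {n} = mk⇔ ⇒ ⇐
  where
  ⇒ : n ≡ 1 → ∀ p → Prime p → ¬ p ∣ n
  ⇒ refl p pr p∣1 = ¬prime[1] (subst Prime (∣1⇒≡1 p∣1) pr)
  ⇐ : (∀ p → Prime p → ¬ p ∣ n) → n ≡ 1
  ⇐ noPrimeDivisor with n ≟ 1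
  ... | yes n≡1 = n≡1
  ... | no  n≢1 with p , pr , p∣n ← ≢1⇒∃primeDivisor n≢1 = contradiction p∣n (noPrimeDivisor p pr)

prime∣2⇒≡2 : Prime p → p ∣ 2 → p ≡ 2
prime∣2⇒≡2 pr p∣2 with prime⇒irreducible prime[2] p∣2
... | inj₁ p≡1 = contradiction (subst Prime p≡1 pr) ¬prime[1]
... | inj₂ p≡2 = p≡2

2*Δ*b+Δ*Δ≡Δ*[2*b+Δ] : ∀ Δ b → 2 * Δ * b + Δ * Δ ≡ Δ * (2 * b + Δ)
2*Δ*b+Δ*Δ≡Δ*[2*b+Δ] = solve-∀

pythagorean-∷ʳ : ∀ {a : Vec ℕ n} {b} Δ → All (0 <_) a → 0 < b → 2 * Δ * b + Δ * Δ ≡ sumSq a →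
                 Pythagorean ((a ∷ʳ b) ∷ʳ (b + Δ))
pythagorean-∷ʳ {a = a} {b} Δ a>0 b>0 2Δb+Δ²≡k = positive , sum≡square
  where
  positive : All (0 <_) ((a ∷ʳ b) ∷ʳ (b + Δ))
  positive = ∷ʳ⁺ (∷ʳ⁺ a>0 b>0) (≤-trans b>0 (m≤m+n b Δ))
  square : ∀ Δ b → 2 * Δ * b + Δ * Δ + b * b ≡ (b + Δ) * (b + Δ)
  square = solve-∀
  sum≡square : sumSq (init ((a ∷ʳ b) ∷ʳ (b + Δ))) ≡ last ((a ∷ʳ b) ∷ʳ (b + Δ)) * last ((a ∷ʳ b) ∷ʳ (b + Δ))
  sum≡square rewrite init-∷ʳ (b + Δ) (a ∷ʳ b) | last-∷ʳ (b + Δ) (a ∷ʳ b) = begin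
    sumSq (a ∷ʳ b)                ≡⟨ sumSq-∷ʳ a b ⟩
    sumSq a + b * b               ≡⟨ cong (_+ b * b) 2Δb+Δ²≡k ⟨
    2 * Δ * b + Δ * Δ + b * b     ≡⟨ square Δ b ⟩
    (b + Δ) * (b + Δ)             ∎
    where open ≡-Reasoning

gcdVec-∷ʳ-∷ʳ≡1⇔ : ∀ (a : Vec ℕ n) b Δ → ¬ 2 ∣ gcdVec a →
  gcdVec ((a ∷ʳ b) ∷ʳ (b + Δ)) ≡ 1 ⇔ (∀ p → Prime p → p ∣ gcdVec a → p ∣ Δ → ¬ p ∣ 2 * b + Δ)
gcdVec-∷ʳ-∷ʳ≡1⇔ a b Δ 2∤g = mk⇔ ⇒ ⇐
  where
  ⇒ : gcdVec ((a ∷ʳ b) ∷ʳ (b + Δ)) ≡ 1 → ∀ p → Prime p → p ∣ gcdVec a → p ∣ Δ → ¬ p ∣ 2 * b + Δ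
  ⇒ g≡1 p pr p∣g p∣Δ p∣2b+Δ =
    to ≡1⇔noPrimeDivisor g≡1 p pr (from (∣gcdVec-∷ʳ-∷ʳ⇔ a) (p∣g , p∣b , ∣m∣n⇒∣m+n p∣b p∣Δ))
    where
    p∣b : p ∣ b
    p∣b with euclidsLemma 2 b pr (∣m+n∣m⇒∣n (subst (p ∣_) (+-comm (2 * b) Δ) p∣2b+Δ) p∣Δ)
    ... | inj₁ p∣2 = contradiction (subst (_∣ gcdVec a) (prime∣2⇒≡2 pr p∣2) p∣g) 2∤g
    ... | inj₂ p∣b = p∣b
  ⇐ : (∀ p → Prime p → p ∣ gcdVec a → p ∣ Δ → ¬ p ∣ 2 * b + Δ) → gcdVec ((a ∷ʳ b) ∷ʳ (b + Δ)) ≡ 1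
  ⇐ coprime = from ≡1⇔noPrimeDivisor λ p pr p∣G →
    let p∣g , p∣b , p∣b+Δ = to (∣gcdVec-∷ʳ-∷ʳ⇔ a) p∣G
        p∣Δ = ∣m+n∣m⇒∣n p∣b+Δ p∣b
    in coprime p pr p∣g p∣Δ (∣m∣n⇒∣m+n (∣n⇒∣m*n 2 p∣b) p∣Δ)

∃[b]2Δb+Δ²≡k⇔Δ∣k×Δ²<k : ∀ Δ k → .{{NonZero Δ}} → ¬ 2 ∣ k →
  (∃[ b ] 0 < b × 2 * Δ * b + Δ * Δ ≡ k) ⇔ (Δ ∣ k × Δ * Δ < k)
∃[b]2Δb+Δ²≡k⇔Δ∣k×Δ²<k Δ k 2∤k = mk⇔ ⇒ ⇐
  where
  ⇒ : ∃[ b ] 0 < b × 2 * Δ * b + Δ * Δ ≡ k → Δ ∣ k × Δ * Δ < k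
  ⇒ (b , b>0 , 2Δb+Δ²≡k) = subst (Δ ∣_) k≡Δ[2b+Δ] (m∣m*n (2 * b + Δ)) ,
                           subst (Δ * Δ <_) k≡Δ[2b+Δ] (*-monoʳ-< Δ (m<n+m Δ (*-monoʳ-< 2 b>0)))
    where
    k≡Δ[2b+Δ] : Δ * (2 * b + Δ) ≡ k
    k≡Δ[2b+Δ] = trans (sym (2*Δ*b+Δ*Δ≡Δ*[2*b+Δ] Δ b)) 2Δb+Δ²≡k
  ⇐ : Δ ∣ k × Δ * Δ < k → ∃[ b ] 0 < b × 2 * Δ * b + Δ * Δ ≡ k
  ⇐ (Δ∣k , Δ²<k) = map₂ (map₂ 2Δb+Δ²≡k) (odd<odd⇒∃[b]n≡2*b+m 2∤Δ 2∤q Δ<q)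
    where
    q : ℕ
    q = quotient Δ∣k
    k≡Δq : k ≡ Δ * q
    k≡Δq = m∣n⇒n≡m*quotient Δ∣k
    2∤Δ : ¬ 2 ∣ Δ
    2∤Δ 2∣Δ = 2∤k (∣-trans 2∣Δ Δ∣k)
    2∤q : ¬ 2 ∣ q
    2∤q 2∣q = 2∤k (∣-trans 2∣q (quotient-∣ Δ∣k))
    Δ<q : Δ < q
    Δ<q = *-cancelˡ-< Δ Δ q (subst (Δ * Δ <_) k≡Δq Δ²<k)
    2Δb+Δ²≡k : ∀ {b} → q ≡ 2 * b + Δ → 2 * Δ * b + Δ * Δ ≡ k
    2Δb+Δ²≡k {b} q≡2b+Δ = trans (2*Δ*b+Δ*Δ≡Δ*[2*b+Δ] Δ b) (sym (trans k≡Δq (cong (Δ *_) q≡2b+Δ)))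

exponentCondition⇔gcdVec-∷ʳ-∷ʳ≡1 : ∀ (a : Vec ℕ n) b Δ → ¬ 2 ∣ gcdVec a →
  2 * Δ * b + Δ * Δ ≡ sumSq a → .{{NonZero (sumSq a)}} →
  (∀ p → Prime p → p ∣ gcdVec a → ExponentZeroOrEqual p Δ (sumSq a)) ⇔ gcdVec ((a ∷ʳ b) ∷ʳ (b + Δ)) ≡ 1
exponentCondition⇔gcdVec-∷ʳ-∷ʳ≡1 a b Δ 2∤g 2Δb+Δ²≡k = mk⇔
  (λ condition → from (gcdVec-∷ʳ-∷ʳ≡1⇔ a b Δ 2∤g) λ p pr p∣g →
    to (exponentZeroOrEqual⇔∤cofactor pr k≡Δ[2b+Δ]) (condition p pr p∣g))
  (λ g≡1 p pr p∣g →
    from (exponentZeroOrEqual⇔∤cofactor pr k≡Δ[2b+Δ]) (to (gcdVec-∷ʳ-∷ʳ≡1⇔ a b Δ 2∤g) g≡1 p pr p∣g))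
  where
  k≡Δ[2b+Δ] : sumSq a ≡ Δ * (2 * b + Δ)
  k≡Δ[2b+Δ] = trans (sym 2Δb+Δ²≡k) (2*Δ*b+Δ*Δ≡Δ*[2*b+Δ] Δ b)

-- The argument works for every length of a.
mainTheorem6 : (n : ℕ) → 4 ≤ n → (a : Vec ℕ (n ∸ 2)) → All (λ x → 0 < x) a → numOdd a % 2 ≡ 1 →
    (Δ : ℕ) → 0 < Δ →
    (Σ ℕ (λ b → (2 * Δ * b + Δ * Δ ≡ sumSq a) × 0 < b × PrimitivePythagorean ((a ∷ʳ b) ∷ʳ (b + Δ))))
    ⇔
    ((Δ ∣ sumSq a) × (Δ * Δ < sumSq a) ×
      ((p : ℕ) → Prime p → p ∣ gcdVec a → (e f : ℕ) → IsExponent p Δ e → IsExponent p (sumSq a) f →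
        (e ≡ 0 ⊎ e ≡ f)))
mainTheorem6 _ _ a a>0 numOdd%2≡1 Δ Δ>0 = mk⇔
  (λ (b , 2Δb+Δ²≡k , b>0 , _ , g≡1) →
    let Δ∣k , Δ²<k = to (∃[b]2Δb+Δ²≡k⇔Δ∣k×Δ²<k Δ k 2∤k) (b , b>0 , 2Δb+Δ²≡k)
    in Δ∣k , Δ²<k , from (exponentCondition⇔gcdVec-∷ʳ-∷ʳ≡1 a b Δ 2∤g 2Δb+Δ²≡k {{k≢0 Δ²<k}}) g≡1)
  (λ (Δ∣k , Δ²<k , condition) →
    let b , b>0 , 2Δb+Δ²≡k = from (∃[b]2Δb+Δ²≡k⇔Δ∣k×Δ²<k Δ k 2∤k) (Δ∣k , Δ²<k)
    in b , 2Δb+Δ²≡k , b>0 , pythagorean-∷ʳ Δ a>0 b>0 2Δb+Δ²≡k ,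
       to (exponentCondition⇔gcdVec-∷ʳ-∷ʳ≡1 a b Δ 2∤g 2Δb+Δ²≡k {{k≢0 Δ²<k}}) condition)
  where
  instance
    Δ≢0 : NonZero Δ
    Δ≢0 = >-nonZero Δ>0
  k : ℕ
  k = sumSq a
  2∤k : ¬ 2 ∣ k
  2∤k = %2≡1⇒¬2∣ (trans (sumSq%2≡numOdd%2 a) numOdd%2≡1)
  2∤g : ¬ 2 ∣ gcdVec a
  2∤g = 2∤k ∘ All∣⇒∣sumSq ∘ to (∣gcdVec⇔All∣ a)
  k≢0 : Δ * Δ < k → NonZero k
  k≢0 Δ²<k = >-nonZero (≤-<-trans z≤n Δ²<k)
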